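{- Let $\mathbf{G}=(\mathbf{A},\forall,\exists)$ be a monadic Gödel algebra and let $\mathbf{K}(\mathbf{G})$ be the associated monadic $N_c$-algebra. For $\theta\in Con(\mathbf{G})$ define the relation $\gamma_\theta$ on $K(A)$ by $(a,b)\,\gamma_\theta\,(x,y)$ iff $(a,x)\in\theta$ and $(b,y)\in\theta$; for $\gamma\in Con(\mathbf{K}(\mathbf{G}))$ define the relation $\theta^\gamma$ on $A$ by $(a,b)\in\theta^\gamma$ iff $(a,0)\,\gamma\,(b,0)$. Then for every $\theta\in Con(\mathbf{G})$ and every $\gamma\in Con(\mathbf{K}(\mathbf{G}))$ we have $\gamma_\theta\in Con(\mathbf{K}(\mathbf{G}))$ and $\theta^\gamma\in Con(\mathbf{G})$.
   Context: $Con(\mathbf{B})$ denotes the lattice of congruences of an algebra $\mathbf{B}$. A Heyting algebra is $\langle A,\vee,\wedge,\Rightarrow,0,1\rangle$ with bounded lattice reduct satisfying $x\wedge(x\Rightarrow y)=x\wedge y$, $x\wedge(y\Rightarrow z)=x\wedge((x\wedge y)\Rightarrow(x\wedge z))$, $(x\wedge y)\Rightarrow x=1$. A monadic Heyting algebra is $(\mathbf{A},\forall,\exists)$ with unary operations satisfying $\forall x\leq x$, $x\leq\exists x$, $\forall(x\wedge y)=\forall x\wedge\forall y$, $\exists(x\vee y)=\exists x\vee\exists y$, $\forall 1=1$, $\exists 0=0$, $\forall\exists x=\exists x$, $\exists\forall x=\forall x$, $\forall(x\Rightarrow y)\leq\exists x\Rightarrow\exists y$. A monadic Gödel algebra is a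 monadic Heyting algebra satisfying $(x\Rightarrow y)\vee(y\Rightarrow x)=1$ and $\forall(\exists x\vee y)=\exists x\vee\forall y$; its congruences are those compatible with $\vee,\wedge,\Rightarrow,\forall,\exists$. $\mathbf{K}(\mathbf{G})$ is the algebra on $K(A)=\{(a,b)\in A\times A:a\wedge b=0\}$ with $(a,b)\vee(d,e)=(a\vee d,b\wedge e)$, $(a,b)\wedge(d,e)=(a\wedge d,b\vee e)$, $(a,b)\to(d,e)=(a\Rightarrow d,a\wedge e)$, $\sim(a,b)=(b,a)$, constants $0=(0,1)$, $1=(1,0)$, and $\exists_K(a,b)=(\exists a,\forall b)$; its congruences are those compatible with $\vee,\wedge,\to,\sim,\exists_K$. -}

module Defs where

open import Level using (Level; _⊔_; suc; 0ℓ)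
open import Data.Product using (Σ; _×_; _,_; proj₁; proj₂)
open import Relation.Binary.Core using (Rel)
open import Relation.Binary.Structures using (IsEquivalence)
open import Relation.Binary.PropositionalEquality using (_≡_)

record MonadicGodel : Set₁ where
  infixr 5 _⇒_
  infixr 6 _∨_
  infixr 7 _∧_
  field
    A : Set
    _∨_ _∧_ _⇒_ : A → A → A
    𝟘 𝟙 : A
    ∀' ∃' : A → A
    ∨-assoc : ∀ x y z → (x ∨ y) ∨ z ≡ x ∨ (y ∨ z)
    ∧-assoc : ∀ x y z → (x ∧ y) ∧ z ≡ x ∧ (y ∧ z)
    ∨-comm  : ∀ x y → x ∨ y ≡ y ∨ x
    ∧-comm  : ∀ x y → x ∧ y ≡ y ∧ x
    ∨-absorbs-∧ : ∀ x y → x ∨ (x ∧ y) ≡ x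
    ∧-absorbs-∨ : ∀ x y → x ∧ (x ∨ y) ≡ x
    ∨-identity : ∀ x → x ∨ 𝟘 ≡ x
    ∧-identity : ∀ x → x ∧ 𝟙 ≡ x
    H1 : ∀ x y → x ∧ (x ⇒ y) ≡ x ∧ y
    H2 : ∀ x y z → x ∧ (y ⇒ z) ≡ x ∧ ((x ∧ y) ⇒ (x ∧ z))
    H3 : ∀ x y → (x ∧ y) ⇒ x ≡ 𝟙
    -- monadic (x ≤ y means x ∧ y ≡ x)
    M1 : ∀ x → ∀' x ∧ x ≡ ∀' x
    M2 : ∀ x → x ∧ ∃' x ≡ x
    M3 : ∀ x y → ∀' (x ∧ y) ≡ ∀' x ∧ ∀' y
    M4 : ∀ x y → ∃' (x ∨ y) ≡ ∃' x ∨ ∃' y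
    M5 : ∀' 𝟙 ≡ 𝟙
    M6 : ∃' 𝟘 ≡ 𝟘
    M7 : ∀ x → ∀' (∃' x) ≡ ∃' x
    M8 : ∀ x → ∃' (∀' x) ≡ ∀' x
    M9 : ∀ x y → ∀' (x ⇒ y) ∧ (∃' x ⇒ ∃' y) ≡ ∀' (x ⇒ y)
    G1 : ∀ x y → (x ⇒ y) ∨ (y ⇒ x) ≡ 𝟙
    G2 : ∀ x y → ∀' (∃' x ∨ y) ≡ ∃' x ∨ ∀' y

module _ (G : MonadicGodel) where
  open MonadicGodel G

  record IsCongG {ℓ : Level} (θ : Rel A ℓ) : Set ℓ where
    field
      isEquivalence : IsEquivalence θ
      cong-∨ : ∀ {a b c d} → θ a b → θ c d → θ (a ∨ c) (b ∨ d)
      cong-∧ : ∀ {a b c d} → θ a b → θ c d → θ (a ∧ c) (b ∧ d)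
      cong-⇒ : ∀ {a b c d} → θ a b → θ c d → θ (a ⇒ c) (b ⇒ d)
      cong-∀ : ∀ {a b} → θ a b → θ (∀' a) (∀' b)
      cong-∃ : ∀ {a b} → θ a b → θ (∃' a) (∃' b)

  KA : Set
  KA = Σ (A × A) (λ p → proj₁ p ∧ proj₂ p ≡ 𝟘)

  _∨K_ _∧K_ _→K_ : A × A → A × A → A × A
  (a , b) ∨K (d , e) = (a ∨ d , b ∧ e)
  (a , b) ∧K (d , e) = (a ∧ d , b ∨ e)
  (a , b) →K (d , e) = (a ⇒ d , a ∧ e)

  ∼K ∃K : A × A → A × A
  ∼K (a , b) = (b , a)
  ∃K (a , b) = (∃' a , ∀' b)

  -- Compatibility is stated for any elements of K(A) whose underlying pairs are
  -- the results of the operations (this avoids re-proving closure of K(A)).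
  record IsCongK {ℓ : Level} (γ : Rel KA ℓ) : Set ℓ where
    field
      isEquivalence : IsEquivalence γ
      cong-∨ : ∀ {u v u' v' w w' : KA} → γ u v → γ u' v' →
               proj₁ w ≡ proj₁ u ∨K proj₁ u' → proj₁ w' ≡ proj₁ v ∨K proj₁ v' → γ w w'
      cong-∧ : ∀ {u v u' v' w w' : KA} → γ u v → γ u' v' →
               proj₁ w ≡ proj₁ u ∧K proj₁ u' → proj₁ w' ≡ proj₁ v ∧K proj₁ v' → γ w w'
      cong-→ : ∀ {u v u' v' w w' : KA} → γ u v → γ u' v' →
               proj₁ w ≡ proj₁ u →K proj₁ u' → proj₁ w' ≡ proj₁ v →K proj₁ v' → γ w w'
      cong-∼ : ∀ {u v w w' : KA} → γ u v →
               proj₁ w ≡ ∼K (proj₁ u) → proj₁ w' ≡ ∼K (proj₁ v) → γ w w'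
      cong-∃ : ∀ {u v w w' : KA} → γ u v →
               proj₁ w ≡ ∃K (proj₁ u) → proj₁ w' ≡ ∃K (proj₁ v) → γ w w'

  γ[_] : {ℓ : Level} → Rel A ℓ → Rel KA ℓ
  γ[ θ ] ((a , b) , _) ((x , y) , _) = θ a x × θ b y

  ⟨_,0⟩ : A → KA
  ⟨ a ,0⟩ = (a , 𝟘) , ∧-annihilates a
    where
    ∧-annihilates : ∀ x → x ∧ 𝟘 ≡ 𝟘
    ∧-annihilates x with ∨-identity (𝟘 ∧ x)
    ... | e = Relation.Binary.PropositionalEquality.trans (∧-comm x 𝟘)
               (Relation.Binary.PropositionalEquality.trans
                 (Relation.Binary.PropositionalEquality.sym e)
                 (Relation.Binary.PropositionalEquality.trans (∨-comm (𝟘 ∧ x) 𝟘) (∨-absorbs-∧ 𝟘 x)))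

  θ^[_] : {ℓ : Level} → Rel KA ℓ → Rel A ℓ
  θ^[ γ ] a b = γ ⟨ a ,0⟩ ⟨ b ,0⟩

-- Every operation of K(G) acts on each coordinate through ∨, ∧, ⇒, ∀, ∃ of G,
-- so γ_θ, which is θ in both coordinates, inherits compatibility from θ.
-- Conversely the operations of G are recovered on the elements (a, 0):
-- ∨, ∧, → and ∃_K act there as ∨, ∧, ⇒, ∃, and ∼ ∃_K ∼ (a, 0) = (∀ a, 0).
module Submission where

open import Defs
open import Level using (Level)
open import Data.Product using (_×_; _,_)
open import Relation.Binary.Core using (Rel)
open import Relation.Binary.Structures using (IsEquivalence)
open import Relation.Binary.PropositionalEquality
  using (_≡_; refl; sym; cong; module ≡-Reasoning)

module _ (G : MonadicGodel) where
  open MonadicGodel G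

  ∧-zeroˡ : ∀ x → 𝟘 ∧ x ≡ 𝟘
  ∧-zeroˡ x = begin
    𝟘 ∧ x         ≡⟨ sym (∨-identity (𝟘 ∧ x)) ⟩
    (𝟘 ∧ x) ∨ 𝟘   ≡⟨ ∨-comm (𝟘 ∧ x) 𝟘 ⟩
    𝟘 ∨ (𝟘 ∧ x)   ≡⟨ ∨-absorbs-∧ 𝟘 x ⟩
    𝟘             ∎
    where open ≡-Reasoning

  ∧-zeroʳ : ∀ x → x ∧ 𝟘 ≡ 𝟘
  ∧-zeroʳ x = begin
    x ∧ 𝟘 ≡⟨ ∧-comm x 𝟘 ⟩
    𝟘 ∧ x ≡⟨ ∧-zeroˡ x ⟩
    𝟘     ∎
    where open ≡-Reasoning

  ∀-zero : ∀' 𝟘 ≡ 𝟘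
  ∀-zero = begin
    ∀' 𝟘      ≡⟨ sym (M1 𝟘) ⟩
    ∀' 𝟘 ∧ 𝟘  ≡⟨ ∧-zeroʳ (∀' 𝟘) ⟩
    𝟘         ∎
    where open ≡-Reasoning

  ⟨0,_⟩ : A → KA G
  ⟨0, a ⟩ = (𝟘 , a) , ∧-zeroˡ a

  module _ {ℓ : Level} {θ : Rel A ℓ} (θ-cong : IsCongG G θ) where
    private
      module θ = IsCongG θ-cong
      module θ-eq = IsEquivalence θ.isEquivalence

    γ-isCongK : IsCongK G (γ[_] G θ)
    γ-isCongK .IsCongK.isEquivalence .IsEquivalence.refl {(_ , _) , _} = θ-eq.refl , θ-eq.refl
    γ-isCongK .IsCongK.isEquivalence .IsEquivalence.sym {(_ , _) , _} {(_ , _) , _} (p , q) =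
      θ-eq.sym p , θ-eq.sym q
    γ-isCongK .IsCongK.isEquivalence .IsEquivalence.trans {(_ , _) , _} {(_ , _) , _} {(_ , _) , _}
      (p , q) (p′ , q′) = θ-eq.trans p p′ , θ-eq.trans q q′
    γ-isCongK .IsCongK.cong-∨ {(_ , _) , _} {(_ , _) , _} {(_ , _) , _} {(_ , _) , _}
      (p , q) (p′ , q′) refl refl = θ.cong-∨ p p′ , θ.cong-∧ q q′
    γ-isCongK .IsCongK.cong-∧ {(_ , _) , _} {(_ , _) , _} {(_ , _) , _} {(_ , _) , _}
      (p , q) (p′ , q′) refl refl = θ.cong-∧ p p′ , θ.cong-∨ q q′
    γ-isCongK .IsCongK.cong-→ {(_ , _) , _} {(_ , _) , _} {(_ , _) , _} {(_ , _) , _}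
      (p , _) (p′ , q′) refl refl = θ.cong-⇒ p p′ , θ.cong-∧ p q′
    γ-isCongK .IsCongK.cong-∼ {(_ , _) , _} {(_ , _) , _} (p , q) refl refl = q , p
    γ-isCongK .IsCongK.cong-∃ {(_ , _) , _} {(_ , _) , _} (p , q) refl refl = θ.cong-∃ p , θ.cong-∀ q

  module _ {ℓ : Level} {γ : Rel (KA G) ℓ} (γ-cong : IsCongK G γ) where
    private
      module γ = IsCongK γ-cong
      module γ-eq = IsEquivalence γ.isEquivalence

    θ^-isCongG : IsCongG G (θ^[_] G γ)
    θ^-isCongG .IsCongG.isEquivalence =
      record { refl = γ-eq.refl ; sym = γ-eq.sym ; trans = γ-eq.trans }
    θ^-isCongG .IsCongG.cong-∨ {a} {b} {c} {d} p q =
      γ.cong-∨ p q (cong (a ∨ c ,_) (sym (∧-zeroˡ 𝟘))) (cong (b ∨ d ,_) (sym (∧-zeroˡ 𝟘)))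
    θ^-isCongG .IsCongG.cong-∧ {a} {b} {c} {d} p q =
      γ.cong-∧ p q (cong (a ∧ c ,_) (sym (∨-identity 𝟘))) (cong (b ∧ d ,_) (sym (∨-identity 𝟘)))
    θ^-isCongG .IsCongG.cong-⇒ {a} {b} {c} {d} p q =
      γ.cong-→ p q (cong (a ⇒ c ,_) (sym (∧-zeroʳ a))) (cong (b ⇒ d ,_) (sym (∧-zeroʳ b)))
    θ^-isCongG .IsCongG.cong-∃ {a} {b} p =
      γ.cong-∃ p (cong (∃' a ,_) (sym ∀-zero)) (cong (∃' b ,_) (sym ∀-zero))
    θ^-isCongG .IsCongG.cong-∀ {a} {b} p = γ.cong-∼ ∃∼-related refl refl
      where
      ∼-related : γ ⟨0, a ⟩ ⟨0, b ⟩
      ∼-related = γ.cong-∼ p refl refl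

      ∃∼-related : γ ⟨0, ∀' a ⟩ ⟨0, ∀' b ⟩
      ∃∼-related = γ.cong-∃ ∼-related (cong (_, ∀' a) (sym M6)) (cong (_, ∀' b) (sym M6))

lemma10 : (G : MonadicGodel) {ℓ : Level} →
    ((θ : Rel (MonadicGodel.A G) ℓ) → IsCongG G θ → IsCongK G (γ[_] G θ)) ×
    ((γ : Rel (KA G) ℓ) → IsCongK G γ → IsCongG G (θ^[_] G γ))
lemma10 G = (λ _ → γ-isCongK G) , (λ _ → θ^-isCongG G)
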